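{- Let $n$ be an even positive integer, $k$ a positive integer, and let $G$ be a graph whose edges are colored with $k$ colors such that $G$ contains no monochromatic connected matching of size $n/2$. For each color $i$ let $G_i$ be the spanning subgraph of edges of color $i$, and for each connected component $C$ of each $G_i$ fix any partition $V(C)=S\cup Q\cup I$ satisfying: (1) $|Q|+2|S|=\min\{v(C),n-1\}$; (2) $I$ is independent in $G_i$, and $I=\emptyset$ if $v(C)\leq n-1$; (3) every vertex of $Q$ has at most one $G_i$-neighbor in $I$; (4) every vertex of $I$ has degree less than $n/2$ in $G_i$. For a vertex $v$ and color $i$, let $S_i^v,Q_i^v,I_i^v$ be the parts of the fixed partition of the component of $G_i$ containing $v$. Call $v$ strong if $v\in S_i^v$ for some $i$; $Q$-saturated if $v\in Q_i^v$ for every $i$; small if $v\in I_i^v$ for some $i$ and $v\in Q_j^v\cup I_j^v$ for all $j$. Define \[F(v)=\begin{cases}\frac{n-1}{4}, & v \text{ strong},\\ k\cdot\frac{n-1}{2}-\frac{\deg_G(v)}{2}, & v\ Q\text{ -saturated},\\ 0, & v \text{ small},\end{cases}\] and $F(G)=k\cdot\frac{n-1}{2}v(G)-e(G)$. Then \[\sum_{v\in V(G)}F(v)\leq F(G).\]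
   Context: Graphs are finite and simple; $v(\cdot)$, $e(\cdot)$ denote numbers of vertices and edges. A monochromatic connected matching of size $n/2$ is a set of $n/2$ pairwise disjoint edges of a single color $i$ all lying in the same connected component of $G_i$. Every vertex is exactly one of strong, $Q$-saturated, small. -}

module Defs where

open import Data.Nat using (ℕ; zero; suc; _+_; _*_; _∸_; _<_; _≤_; _⊓_)
open import Data.Nat.Properties using (_<?_)
open import Data.Fin using (Fin; toℕ)
open import Data.Fin.Properties using () renaming (_≟_ to _≟ᶠ_)
open import Data.Fin.Subset using (Subset; _∈_; ∣_∣)
open import Data.List using (List; length; filter; filterᵇ; map; allFin)
open import Data.Nat.ListAction using (sum)
open import Data.Bool.ListAction using (any)
open import Data.Maybe using (Maybe; just; nothing; is-just)
open import Data.Maybe.Properties using (≡-dec)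
open import Data.Bool using (Bool; true; false; if_then_else_)
open import Data.Integer using (ℤ; +_; _-_)
open import Data.Product using (Σ; _×_; _,_; proj₁; proj₂; ∃)
open import Data.Sum using (_⊎_)
open import Function.Bundles using (_⇔_)
open import Relation.Nullary using (¬_; Dec; yes; no; does)
open import Relation.Binary.PropositionalEquality using (_≡_; _≢_)

-- Edge-coloured finite simple graphs on vertex set Fin N with k colours.
-- col u v = just i  : uv is an edge of colour i
-- col u v = nothing : uv is not an edge

record ColGraph (N k : ℕ) : Set where
  field
    col   : Fin N → Fin N → Maybe (Fin k)
    sym   : ∀ u v → col u v ≡ col v u
    irrefl : ∀ v → col v v ≡ nothing
open ColGraph public

module _ {N k : ℕ} (G : ColGraph N k) where

  Edge : Fin k → Fin N → Fin N → Set
  Edge i u v = col G u v ≡ just i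

  edge? : ∀ i u v → Dec (Edge i u v)
  edge? i u v = ≡-dec _≟ᶠ_ (col G u v) (just i)

  data Reach (i : Fin k) : Fin N → Fin N → Set where
    here : ∀ {u} → Reach i u u
    step : ∀ {u w v} → Edge i u w → Reach i w v → Reach i u v

  deg : Fin N → ℕ
  deg v = length (filterᵇ (λ u → is-just (col G v u)) (allFin N))

  degᵢ : Fin k → Fin N → ℕ
  degᵢ i v = length (filter (edge? i v) (allFin N))

  numEdges : ℕ
  numEdges = sum (map (λ u → length (filterᵇ (λ v → if does (toℕ u <? toℕ v)
                                                     then is-just (col G u v) else false)
                                               (allFin N)))
                      (allFin N))

  MonoConnMatching : ℕ → Set
  MonoConnMatching m =
    Σ (Fin k) λ i → Σ (Fin m → Fin N × Fin N) λ f →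
      (∀ j → Edge i (proj₁ (f j)) (proj₂ (f j))) ×
      (∀ j j' → j ≢ j' →
          proj₁ (f j) ≢ proj₁ (f j') × proj₁ (f j) ≢ proj₂ (f j') ×
          proj₂ (f j) ≢ proj₁ (f j') × proj₂ (f j) ≢ proj₂ (f j')) ×
      Σ (Fin N) λ r → ∀ j → Reach i r (proj₁ (f j)) × Reach i r (proj₂ (f j))

-- Partition labels: part i v says whether v lies in S, Q or I of the fixed
-- partition of the component of G_i containing v.

data Part : Set where
  S Q I : Part

isS isI : Part → Bool
isS S = true
isS _ = false
isI I = true
isI _ = false

_represents_ : ∀ {N} → Subset N → (Fin N → Set) → Set
s represents P = ∀ x → (x ∈ s) ⇔ P x

module _ {N k : ℕ} (G : ColGraph N k) (n : ℕ) (part : Fin k → Fin N → Part) where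

  ValidPartition : Set
  ValidPartition =
    (∀ i v (sS sQ sC : Subset N) →
       sS represents (λ x → Reach G i v x × part i x ≡ S) →
       sQ represents (λ x → Reach G i v x × part i x ≡ Q) →
       sC represents (λ x → Reach G i v x) →
       ∣ sQ ∣ + 2 * ∣ sS ∣ ≡ ∣ sC ∣ ⊓ (n ∸ 1)) ×
    (∀ i u w → Edge G i u w → part i u ≡ I → part i w ≢ I) ×
    (∀ i v (sC : Subset N) → sC represents (λ x → Reach G i v x) →
       ∣ sC ∣ ≤ n ∸ 1 → part i v ≢ I) ×
    (∀ i v → part i v ≡ Q →
       length (filterᵇ (λ u → if does (edge? G i v u) then isI (part i u) else false)
                       (allFin N)) ≤ 1) ×
    -- (4) every vertex of I has degree < n/2 in G_i  (written 2·deg < n)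
    (∀ i v → part i v ≡ I → 2 * degᵢ G i v < n)

  Strong QSaturated Small : Fin N → Set
  Strong v = ∃ λ i → part i v ≡ S
  QSaturated v = ∀ i → part i v ≡ Q
  Small v = (∃ λ i → part i v ≡ I) × (∀ j → part j v ≡ Q ⊎ part j v ≡ I)

  -- 4·F(v)  (values scaled by 4 to stay in ℤ)
  F4 : Fin N → ℤ
  F4 v = if any (λ i → isS (part i v)) (allFin k) then + (n ∸ 1)
         else if any (λ i → isI (part i v)) (allFin k) then + 0
         else (+ (2 * k * (n ∸ 1))) - (+ (2 * deg G v))

  sumF4 : ℤ
  sumF4 = Data.List.foldr Data.Integer._+_ (+ 0) (map F4 (allFin N))

FG4 : ∀ {N k} → ColGraph N k → ℕ → ℤ
FG4 {N} {k} G n = (+ (2 * k * (n ∸ 1) * N)) - (+ (4 * numEdges G))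

module Submission where

-- For a colour i give v the weight m if v ∈ S, 2m - 2 d_i(v) if v ∈ Q and 0
-- if v ∈ I.  Then 4F(v) is at most the total weight of v over all colours
-- (a strong vertex collects m from a colour where it lies in S, a Q-saturated
-- one collects ∑_i (2m - 2 d_i(v)) = 2km - 2 deg v), so it suffices to show the
-- per-colour bound ∑_v (weight + 2 d_i(v)) ≤ 2mN and to sum it over the
-- colours, using ∑_v deg v = 2 e(G).  The per-colour bound charges the edges
-- of G_i to their endpoints (double counting the S–I and I–Q edges), bounds the
-- charges of a vertex by the counts of the parts of its component, and
-- finishes with an arithmetic inequality on each component, which is where
-- conditions (1)–(3) enter.

open import Defs hiding (sym)
open import Data.Nat using (ℕ; zero; suc; _+_; _*_; _∸_; _/_; _≤_; _<_; _⊓_; _<ᵇ_; z≤n)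
open import Data.Nat.Properties
open import Data.Nat.Divisibility using (_∣_)
open import Data.Nat.Solver using (module +-*-Solver)
open +-*-Solver using (solve; _:+_; _:*_; con; _:=_)
open import Data.Nat.ListAction as ListSum using ()
open import Algebra.Properties.Semiring.Sum +-*-semiring
  using (sum; sum-syntax; sum-cong-≗; ∑-distrib-+; ∑-comm; *-distribˡ-sum; *-distribʳ-sum)
import Data.Integer as ℤ
open import Data.Integer using (ℤ)
import Data.Integer.Properties as ℤP
open import Data.Bool using (Bool; true; false; T; _∧_; _∨_; not; if_then_else_)
open import Data.Bool.Properties using (T-≡)
open import Data.Bool.ListAction using (any)
open import Data.Fin using (Fin; zero; suc; toℕ)
open import Data.Fin.Properties using (toℕ-injective) renaming (_≟_ to _≟ᶠ_)
open import Data.Fin.Subset using (∣_∣)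
open import Data.List using (List; []; _∷_; length; filter; filterᵇ; map; foldr; allFin)
open import Data.List.Relation.Unary.Any using (satisfied)
open import Data.List.Relation.Unary.Any.Properties using (any⁺; any⁻)
open import Data.List.Membership.Propositional using (lose)
open import Data.List.Membership.Propositional.Properties using (∈-allFin)
import Data.Vec as Vec
open import Data.Vec.Properties using (lookup∘tabulate; []=⇒lookup; lookup⇒[]=)
open import Data.Maybe as Maybe using (Maybe; just; nothing; fromMaybe; is-just)
open import Data.Maybe.Properties using (≡-dec)
open import Data.Product using (∃; _×_; _,_; proj₁; proj₂)
open import Data.Empty using (⊥-elim)
open import Function using (_∘_; id)
open import Function.Bundles using (Equivalence; mk⇔)
open import Relation.Nullary using (¬_; Dec; yes; no; does)
open import Relation.Nullary.Decidable using (T?; dec-true; dec-false)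
open import Relation.Binary.Definitions using (tri<; tri≈; tri>)
open import Relation.Binary.PropositionalEquality

𝟙 : Bool → ℕ
𝟙 true = 1
𝟙 false = 0

count : ∀ {n} → (Fin n → Bool) → ℕ
count {n} p = ∑[ x < n ] 𝟙 (p x)

true≢false : true ≢ false
true≢false ()

∧-true : ∀ a {b} → a ∧ b ≡ true → a ≡ true × b ≡ true
∧-true true {true} _ = refl , refl

not-true : ∀ {a} → not a ≡ true → a ≡ false
not-true {false} _ = refl

∧-intro : ∀ {a b} → a ≡ true → b ≡ true → a ∧ b ≡ true
∧-intro refl refl = refl

∑-mono-≤ : ∀ {n} {f g : Fin n → ℕ} → (∀ x → f x ≤ g x) → sum f ≤ sum g
∑-mono-≤ {zero} f≤g = z≤n
∑-mono-≤ {suc n} f≤g = +-mono-≤ (f≤g zero) (∑-mono-≤ (f≤g ∘ suc))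

∑-mono-< : ∀ {n} {f g : Fin n → ℕ} (a : Fin n) → (∀ x → f x ≤ g x) → f a < g a → sum f < sum g
∑-mono-< zero f≤g fa<ga = +-mono-<-≤ fa<ga (∑-mono-≤ (f≤g ∘ suc))
∑-mono-< (suc a) f≤g fa<ga = +-mono-≤-< (f≤g zero) (∑-mono-< a (f≤g ∘ suc) fa<ga)

∑-term : ∀ {n} (f : Fin n → ℕ) (a : Fin n) → f a ≤ sum f
∑-term f zero = m≤m+n (f zero) _
∑-term f (suc a) = ≤-trans (∑-term (f ∘ suc) a) (m≤n+m _ (f zero))

∑-const : ∀ n (c : ℕ) → ∑[ _ < n ] c ≡ n * c
∑-const zero c = refl
∑-const (suc n) c = cong (c +_) (∑-const n c)

count≤size : ∀ {n} (p : Fin n → Bool) → count p ≤ n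
count≤size {n} p = ≤-trans (∑-mono-≤ (𝟙≤1 ∘ p)) (≤-reflexive (trans (∑-const n 1) (*-identityʳ n)))
  where
  𝟙≤1 : ∀ b → 𝟙 b ≤ 1
  𝟙≤1 true = ≤-refl
  𝟙≤1 false = z≤n

∑-+2* : ∀ {n} (f g : Fin n → ℕ) → ∑[ v < n ] (f v + 2 * g v) ≡ sum f + 2 * sum g
∑-+2* f g = trans (∑-distrib-+ f (λ v → 2 * g v)) (cong (sum f +_) (sym (*-distribˡ-sum 2 g)))

∑-δ : ∀ {n} (a : Fin n) → ∑[ r < n ] 𝟙 (does (a ≟ᶠ r)) ≡ 1
∑-δ {suc n} zero = cong suc (trans (sum-cong-≗ {n} {λ r → 𝟙 (does (zero ≟ᶠ suc r))} {λ _ → 0} (λ _ → refl))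
                                  (trans (∑-const n 0) (*-zeroʳ n)))
∑-δ {suc n} (suc a) = trans (sum-cong-≗ δ-suc) (∑-δ a)
  where
  δ-suc : ∀ r → 𝟙 (does (suc a ≟ᶠ suc r)) ≡ 𝟙 (does (a ≟ᶠ r))
  δ-suc r with a ≟ᶠ r
  ... | yes _ = refl
  ... | no _ = refl

double-count : ∀ {n} (E : Fin n → Fin n → Bool) → (∀ u v → E u v ≡ E v u) → (A B : Fin n → Bool) →
  ∑[ v < n ] (𝟙 (A v) * count (λ x → E v x ∧ B x)) ≡ ∑[ v < n ] (𝟙 (B v) * count (λ x → E v x ∧ A x))
double-count {n} E E-sym A B = begin
  ∑[ v < n ] (𝟙 (A v) * count (λ x → E v x ∧ B x))
    ≡⟨ sum-cong-≗ (λ v → *-distribˡ-sum (𝟙 (A v)) (λ x → 𝟙 (E v x ∧ B x))) ⟩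
  ∑[ v < n ] ∑[ x < n ] (𝟙 (A v) * 𝟙 (E v x ∧ B x))
    ≡⟨ ∑-comm (λ v x → 𝟙 (A v) * 𝟙 (E v x ∧ B x)) ⟩
  ∑[ x < n ] ∑[ v < n ] (𝟙 (A v) * 𝟙 (E v x ∧ B x))
    ≡⟨ sum-cong-≗ (λ x → sum-cong-≗ (λ v → pair-swap (A v) (B x) (E-sym v x))) ⟩
  ∑[ x < n ] ∑[ v < n ] (𝟙 (B x) * 𝟙 (E x v ∧ A v))
    ≡⟨ sum-cong-≗ (λ x → sym (*-distribˡ-sum (𝟙 (B x)) (λ v → 𝟙 (E x v ∧ A v)))) ⟩
  ∑[ x < n ] (𝟙 (B x) * count (λ v → E x v ∧ A v)) ∎
  where
  open ≡-Reasoning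
  pair-swap : ∀ a b {e e′} → e ≡ e′ → 𝟙 a * 𝟙 (e ∧ b) ≡ 𝟙 b * 𝟙 (e′ ∧ a)
  pair-swap true true {true} refl = refl
  pair-swap true false {true} refl = refl
  pair-swap false true {true} refl = refl
  pair-swap false false {true} refl = refl
  pair-swap a b {false} refl = trans (*-zeroʳ (𝟙 a)) (sym (*-zeroʳ (𝟙 b)))

length-filter : ∀ {A : Set} {P : A → Set} (P? : ∀ x → Dec (P x)) (xs : List A) →
  length (filter P? xs) ≡ ListSum.sum (map (𝟙 ∘ does ∘ P?) xs)
length-filter P? [] = refl
length-filter P? (x ∷ xs) with does (P? x)
... | true = cong suc (length-filter P? xs)
... | false = length-filter P? xs

sum-map-allFin : ∀ {n} (f : Fin n → ℕ) → ListSum.sum (map f (allFin n)) ≡ sum f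
sum-map-allFin {n} f = go f id
  where
  go : ∀ {m} {A : Set} (g : A → ℕ) (h : Fin m → A) →
       ListSum.sum (map g (Data.List.tabulate h)) ≡ sum (g ∘ h)
  go {zero} g h = refl
  go {suc m} g h = cong (g (h zero) +_) (go g (h ∘ suc))

length-filter-allFin : ∀ {n} {P : Fin n → Set} (P? : ∀ x → Dec (P x)) →
  length (filter P? (allFin n)) ≡ count (does ∘ P?)
length-filter-allFin {n} P? = trans (length-filter P? (allFin n)) (sum-map-allFin (𝟙 ∘ does ∘ P?))

length-filterᵇ-allFin : ∀ {n} (p : Fin n → Bool) → length (filterᵇ p (allFin n)) ≡ count p
length-filterᵇ-allFin p = trans (length-filter-allFin (T? ∘ p)) (sum-cong-≗ (does-T? ∘ p))
  where
  does-T? : ∀ b → 𝟙 (does (T? b)) ≡ 𝟙 b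
  does-T? true = refl
  does-T? false = refl

∣tabulate∣ : ∀ {n} (p : Fin n → Bool) → ∣ Vec.tabulate p ∣ ≡ count p
∣tabulate∣ {zero} p = refl
∣tabulate∣ {suc n} p with p zero
... | true = cong suc (∣tabulate∣ (p ∘ suc))
... | false = ∣tabulate∣ (p ∘ suc)

represents-tabulate : ∀ {n} (p : Fin n → Bool) {Q : Fin n → Set} →
  (∀ {x} → p x ≡ true → Q x) → (∀ {x} → Q x → p x ≡ true) → Vec.tabulate p represents Q
represents-tabulate p sound complete x = mk⇔
  (λ x∈p → sound (trans (sym (lookup∘tabulate p x)) ([]=⇒lookup x∈p)))
  (λ Qx → lookup⇒[]= x _ (trans (lookup∘tabulate p x) (complete Qx)))

any-intro : ∀ {n} (p : Fin n → Bool) x → p x ≡ true → any p (allFin n) ≡ true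
any-intro p x px = Equivalence.to T-≡ (any⁺ p (lose (∈-allFin x) (Equivalence.from T-≡ px)))

any-elim : ∀ {n} (p : Fin n → Bool) → any p (allFin n) ≡ true → ∃ λ x → p x ≡ true
any-elim {n} p h with satisfied (any⁻ p (allFin n) (Equivalence.from T-≡ h))
... | x , px = x , Equivalence.to T-≡ px

any-false : ∀ {n} (p : Fin n → Bool) → any p (allFin n) ≡ false → ∀ x → p x ≡ false
any-false p h x with p x in px
... | false = refl
... | true = ⊥-elim (true≢false (trans (sym (any-intro p x px)) h))

-- The vertices reachable
-- from u are obtained by repeatedly adding all neighbours to {u} as long as
-- some edge of G_i leaves the current set; every round adds a vertex, so N
-- rounds reach a closed set, which then is exactly the component of u.
module Connectivity {N k : ℕ} (G : ColGraph N k) (i : Fin k) where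

  adj : Fin N → Fin N → Bool
  adj u v = does (edge? G i u v)

  adj-sound : ∀ {u v} → adj u v ≡ true → Edge G i u v
  adj-sound {u} {v} h with edge? G i u v
  ... | yes e = e

  adj-complete : ∀ {u v} → Edge G i u v → adj u v ≡ true
  adj-complete {u} {v} e with edge? G i u v
  ... | yes _ = refl
  ... | no ¬e = ⊥-elim (¬e e)

  adj-sym : ∀ u v → adj u v ≡ adj v u
  adj-sym u v rewrite ColGraph.sym G u v = refl

  adj-irrefl : ∀ v → adj v v ≡ false
  adj-irrefl v rewrite ColGraph.irrefl G v = refl

  edge-sym : ∀ {u v} → Edge G i u v → Edge G i v u
  edge-sym {u} {v} e = trans (ColGraph.sym G v u) e

  reach-snoc : ∀ {u w x} → Reach G i u w → Edge G i w x → Reach G i u x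
  reach-snoc here e = step e here
  reach-snoc (step e′ r) e = step e′ (reach-snoc r e)

  reach-trans : ∀ {u w x} → Reach G i u w → Reach G i w x → Reach G i u x
  reach-trans here r = r
  reach-trans (step e r) r′ = step e (reach-trans r r′)

  reach-sym : ∀ {u x} → Reach G i u x → Reach G i x u
  reach-sym here = here
  reach-sym (step e r) = reach-snoc (reach-sym r) (edge-sym e)

  Closed : (Fin N → Bool) → Set
  Closed X = ∀ {y x} → X y ≡ true → adj y x ≡ true → X x ≡ true

  closed-reach : ∀ {X u x} → Closed X → X u ≡ true → Reach G i u x → X x ≡ true
  closed-reach c Xu here = Xu
  closed-reach c Xu (step e r) = closed-reach c (c Xu (adj-complete e)) r

  grow : (Fin N → Bool) → Fin N → Bool
  grow X x = X x ∨ any (λ y → X y ∧ adj y x) (allFin N)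

  leaks : (Fin N → Bool) → Bool
  leaks X = any (λ y → any (λ x → X y ∧ adj y x ∧ not (X x)) (allFin N)) (allFin N)

  close : ℕ → (Fin N → Bool) → Fin N → Bool
  close zero X = X
  close (suc t) X = if leaks X then close t (grow X) else X

  grow-⊇ : ∀ X x → X x ≡ true → grow X x ≡ true
  grow-⊇ X x Xx rewrite Xx = refl

  close-⊇ : ∀ t X x → X x ≡ true → close t X x ≡ true
  close-⊇ zero X x Xx = Xx
  close-⊇ (suc t) X x Xx with leaks X
  ... | true = close-⊇ t (grow X) x (grow-⊇ X x Xx)
  ... | false = Xx

  not-leaks-closed : ∀ X → leaks X ≡ false → Closed X
  not-leaks-closed X nl {y} {x} Xy yx with X x in Xx
  ... | true = refl
  ... | false = ⊥-elim (true≢false (trans (sym (any-intro _ x edge-out)) (any-false _ nl y)))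
    where
    edge-out : X y ∧ adj y x ∧ not (X x) ≡ true
    edge-out rewrite Xy | yx | Xx = refl

  leaks-grows : ∀ X → leaks X ≡ true → count X < count (grow X)
  leaks-grows X l with any-elim _ l
  ... | y , l′ with any-elim _ l′
  ... | x , out with ∧-true (X y) out
  ... | Xy , yx′ with ∧-true (adj y x) yx′
  ... | yx , notXx = ∑-mono-< x (λ z → 𝟙-mono (grow-⊇ X z)) new
    where
    𝟙-mono : ∀ {a b} → (a ≡ true → b ≡ true) → 𝟙 a ≤ 𝟙 b
    𝟙-mono {false} _ = z≤n
    𝟙-mono {true} a⇒b rewrite a⇒b refl = ≤-refl
    new : 𝟙 (X x) < 𝟙 (grow X x)
    new rewrite not-true notXx
              | any-intro (λ y → X y ∧ adj y x) y (subst₂ (λ a b → a ∧ b ≡ true) (sym Xy) (sym yx) refl) = ≤-refl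

  close-closed : ∀ t X → N ≤ t + count X → Closed (close t X)
  close-closed zero X big with leaks X in l
  ... | false = not-leaks-closed X l
  ... | true = ⊥-elim (<⇒≱ (≤-<-trans big (leaks-grows X l)) (count≤size (grow X)))
  close-closed (suc t) X big with leaks X in l
  ... | false = not-leaks-closed X l
  ... | true = close-closed t (grow X)
    (≤-trans big (≤-trans (≤-reflexive (sym (+-suc t _))) (+-monoʳ-≤ t (leaks-grows X l))))

  grow-reach : ∀ {u} X → (∀ x → X x ≡ true → Reach G i u x) → ∀ x → grow X x ≡ true → Reach G i u x
  grow-reach X inside x g with X x in Xx
  ... | true = inside x Xx
  ... | false with any-elim _ g
  ... | y , Xy∧yx with ∧-true (X y) Xy∧yx
  ... | Xy , yx = reach-snoc (inside y Xy) (adj-sound yx)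

  close-reach : ∀ {u} t X → (∀ x → X x ≡ true → Reach G i u x) → ∀ x → close t X x ≡ true → Reach G i u x
  close-reach zero X inside = inside
  close-reach (suc t) X inside x c with leaks X
  ... | true = close-reach t (grow X) (grow-reach X inside) x c
  ... | false = inside x c

  reachable : Fin N → Fin N → Bool
  reachable u = close N (λ x → does (x ≟ᶠ u))

  reachable-complete : ∀ {u x} → Reach G i u x → reachable u x ≡ true
  reachable-complete {u} = closed-reach (close-closed N _ (m≤m+n N _)) (close-⊇ N _ u (dec-true (u ≟ᶠ u) refl))

  reachable-sound : ∀ {u x} → reachable u x ≡ true → Reach G i u x
  reachable-sound {u} {x} = close-reach N _ start x
    where
    start : ∀ x → does (x ≟ᶠ u) ≡ true → Reach G i u x
    start x _ with x ≟ᶠ u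
    ... | yes refl = here

  reachable-self : ∀ v → reachable v v ≡ true
  reachable-self v = reachable-complete here

  reachable-cong : ∀ {v w} → Reach G i v w → ∀ x → reachable v x ≡ reachable w x
  reachable-cong {v} {w} vw x with reachable v x in vx | reachable w x in wx
  ... | true | true = refl
  ... | false | false = refl
  ... | true | false = ⊥-elim (true≢false (trans (sym (reachable-complete (reach-trans (reach-sym vw) (reachable-sound vx)))) wx))
  ... | false | true = ⊥-elim (true≢false (trans (sym (reachable-complete (reach-trans vw (reachable-sound wx)))) vx))

first : ∀ {n} → (Fin n → Bool) → Maybe (Fin n)
first {zero} p = nothing
first {suc n} p = if p zero then just zero else Maybe.map suc (first (p ∘ suc))

first-cong : ∀ {n} {p q : Fin n → Bool} → (∀ x → p x ≡ q x) → first p ≡ first q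
first-cong {zero} p≗q = refl
first-cong {suc n} {p} {q} p≗q rewrite p≗q zero | first-cong {p = p ∘ suc} (p≗q ∘ suc) = refl

first-found : ∀ {n} (p : Fin n → Bool) x → p x ≡ true → ∃ λ y → first p ≡ just y × p y ≡ true
first-found {suc n} p x px with p zero in p0
... | true = zero , refl , p0
first-found {suc n} p zero px | false = ⊥-elim (true≢false (trans (sym px) p0))
first-found {suc n} p (suc x) px | false with first-found (p ∘ suc) x px
... | y , found , py rewrite found = suc y , refl , py

module Components {N k : ℕ} (G : ColGraph N k) (i : Fin k) where
  open Connectivity G i

  rep : Fin N → Fin N
  rep v = fromMaybe v (first (reachable v))

  rep-reach : ∀ v → Reach G i v (rep v)
  rep-reach v with first-found (reachable v) v (reachable-self v)
  ... | y , found , vy rewrite found = reachable-sound vy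

  rep-cong : ∀ {v w} → Reach G i v w → rep v ≡ rep w
  rep-cong {v} {w} vw with first-found (reachable v) v (reachable-self v)
  ... | y , found , _ = begin
    fromMaybe v (first (reachable v)) ≡⟨ cong (fromMaybe v) found ⟩
    y                                 ≡⟨ cong (fromMaybe w) (trans (sym found) (first-cong (reachable-cong vw))) ⟩
    fromMaybe w (first (reachable w)) ∎
    where open ≡-Reasoning

  leader : Fin N → Bool
  leader r = does (rep r ≟ᶠ r)

  is-rep : ∀ r v → 𝟙 (does (rep v ≟ᶠ r)) ≡ 𝟙 (leader r) * 𝟙 (reachable r v)
  is-rep r v with rep v ≟ᶠ r
  ... | yes refl rewrite reachable-complete (reach-sym (rep-reach v)) with rep (rep v) ≟ᶠ rep v
  ...   | yes _ = refl
  ...   | no rep≢rep = ⊥-elim (rep≢rep (sym (rep-cong (rep-reach v))))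
  is-rep r v | no rep≢r with reachable r v in rv
  ... | false = sym (*-zeroʳ (𝟙 (leader r)))
  ... | true with rep r ≟ᶠ r
  ...   | no _ = refl
  ...   | yes rep≡r = ⊥-elim (rep≢r (trans (rep-cong (reach-sym (reachable-sound rv))) rep≡r))

  ∑-by-components : (f : Fin N → ℕ) →
    sum f ≡ ∑[ r < N ] (𝟙 (leader r) * ∑[ v < N ] (𝟙 (reachable r v) * f v))
  ∑-by-components f = begin
    sum f
      ≡⟨ sum-cong-≗ (λ v → sym (trans (sym (*-distribʳ-sum (f v) (λ r → 𝟙 (does (rep v ≟ᶠ r)))))
                                       (trans (cong (_* f v) (∑-δ (rep v))) (*-identityˡ (f v))))) ⟩
    ∑[ v < N ] ∑[ r < N ] (𝟙 (does (rep v ≟ᶠ r)) * f v)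
      ≡⟨ ∑-comm (λ v r → 𝟙 (does (rep v ≟ᶠ r)) * f v) ⟩
    ∑[ r < N ] ∑[ v < N ] (𝟙 (does (rep v ≟ᶠ r)) * f v)
      ≡⟨ sum-cong-≗ (λ r → sum-cong-≗ (λ v → trans (cong (_* f v) (is-rep r v))
                                                   (*-assoc (𝟙 (leader r)) (𝟙 (reachable r v)) (f v)))) ⟩
    ∑[ r < N ] ∑[ v < N ] (𝟙 (leader r) * (𝟙 (reachable r v) * f v))
      ≡⟨ sum-cong-≗ (λ r → sym (*-distribˡ-sum (𝟙 (leader r)) (λ v → 𝟙 (reachable r v) * f v))) ⟩
    ∑[ r < N ] (𝟙 (leader r) * ∑[ v < N ] (𝟙 (reachable r v) * f v)) ∎
    where open ≡-Reasoning

  ∑-mono-by-components : (f g : Fin N → ℕ) →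
    (∀ r → ∑[ v < N ] (𝟙 (reachable r v) * f v) ≤ ∑[ v < N ] (𝟙 (reachable r v) * g v)) →
    sum f ≤ sum g
  ∑-mono-by-components f g on-each = subst₂ _≤_ (sym (∑-by-components f)) (sym (∑-by-components g))
    (∑-mono-≤ (λ r → *-monoʳ-≤ (𝟙 (leader r)) (on-each r)))

is : Part → Part → Bool
is S S = true
is Q Q = true
is I I = true
is _ _ = false

is-sound : ∀ X p → is X p ≡ true → p ≡ X
is-sound S S _ = refl
is-sound Q Q _ = refl
is-sound I I _ = refl

is-refl : ∀ X → is X X ≡ true
is-refl S = refl
is-refl Q = refl
is-refl I = refl

byPart : Part → ℕ → ℕ → ℕ → ℕ
byPart S a b c = a
byPart Q a b c = b
byPart I a b c = c

count-by-part : ∀ {n} (b : Fin n → Bool) (P : Fin n → Part) →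
  count b ≡ count (λ x → b x ∧ is S (P x)) + count (λ x → b x ∧ is Q (P x)) + count (λ x → b x ∧ is I (P x))
count-by-part b P = trans (sum-cong-≗ (λ x → split (b x) (P x)))
  (trans (∑-distrib-+ (λ x → 𝟙 (b x ∧ is S (P x)) + 𝟙 (b x ∧ is Q (P x))) (λ x → 𝟙 (b x ∧ is I (P x))))
         (cong (_+ count (λ x → b x ∧ is I (P x))) (∑-distrib-+ (λ x → 𝟙 (b x ∧ is S (P x))) (λ x → 𝟙 (b x ∧ is Q (P x))))))
  where
  split : ∀ a p → 𝟙 a ≡ 𝟙 (a ∧ is S p) + 𝟙 (a ∧ is Q p) + 𝟙 (a ∧ is I p)
  split false p = refl
  split true S = refl
  split true Q = refl
  split true I = refl

small-component-no-S : ∀ s q c → c ≡ s + q → q + 2 * s ≡ c → s ≡ 0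
small-component-no-S s q c c≡ size = +-cancelʳ-≡ (s + q) s 0 (begin
  s + (s + q) ≡⟨ solve 2 (λ s q → s :+ (s :+ q) := q :+ con 2 :* s) refl s q ⟩
  q + 2 * s   ≡⟨ trans size c≡ ⟩
  s + q       ∎)
  where open ≡-Reasoning

large-component-I : ∀ m s q t c → c ≡ s + q + t → q + 2 * s ≡ m → m < c → s + 1 ≤ t
large-component-I m s q t c c≡ size m<c = +-cancelˡ-≤ (s + q) (s + 1) t (begin
  s + q + (s + 1) ≡⟨ solve 2 (λ s q → s :+ q :+ (s :+ con 1) := con 1 :+ (q :+ con 2 :* s)) refl s q ⟩
  suc (q + 2 * s) ≡⟨ cong suc size ⟩
  suc m           ≤⟨ m<c ⟩
  c               ≡⟨ c≡ ⟩
  s + q + t       ∎)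
  where open ≤-Reasoning

-- Balance of weights on a large component, where m = q + 2s and t = s + 1 + u.
large-component : ∀ s q t c → c ≡ s + q + t → q + 2 * s < c →
  let m = q + 2 * s in
  s * (m + 2 * (s + q)) + q * (2 * m + 2 * 1) + t * (4 * s) ≤ s * (2 * m + 2) + q * (2 * m) + t * (2 * m)
large-component s q t c c≡ m<c =
  subst (λ t → s * (m + 2 * (s + q)) + q * (2 * m + 2 * 1) + t * (4 * s) ≤ s * (2 * m + 2) + q * (2 * m) + t * (2 * m))
        (m+[n∸m]≡n (large-component-I m s q t c c≡ refl m<c))
        (≤-trans (m≤m+n _ (q * s + 2 * s + 2 * (u * q))) (≤-reflexive identity))
  where
  m u : ℕ
  m = q + 2 * s
  u = t ∸ (s + 1)
  identity : s * ((q + 2 * s) + 2 * (s + q)) + q * (2 * (q + 2 * s) + 2 * 1) + (s + 1 + u) * (4 * s)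
               + (q * s + 2 * s + 2 * (u * q))
           ≡ s * (2 * (q + 2 * s) + 2) + q * (2 * (q + 2 * s)) + (s + 1 + u) * (2 * (q + 2 * s))
  identity = solve 3 (λ s q u →
      s :* ((q :+ con 2 :* s) :+ con 2 :* (s :+ q)) :+ q :* (con 2 :* (q :+ con 2 :* s) :+ con 2 :* con 1)
        :+ (s :+ con 1 :+ u) :* (con 4 :* s) :+ (q :* s :+ con 2 :* s :+ con 2 :* (u :* q))
    := s :* (con 2 :* (q :+ con 2 :* s) :+ con 2) :+ q :* (con 2 :* (q :+ con 2 :* s))
        :+ (s :+ con 1 :+ u) :* (con 2 :* (q :+ con 2 :* s))) refl s q u

<ᵇ-true : ∀ m c → (m <ᵇ c) ≡ true → m < c
<ᵇ-true m c b = <ᵇ⇒< m c (subst T (sym b) _)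

<ᵇ-false : ∀ m c → (m <ᵇ c) ≡ false → c ≤ m
<ᵇ-false m c b = ≮⇒≥ (λ m<c → subst T b (<⇒<ᵇ m<c))

-- The inequality behind the per-colour bound, for one component of G_i with
-- s, q, t vertices in S, Q, I (c = s + q + t in total, m = n - 1).  Condition
-- (1) says q + 2s = min(c, m) and (2b) says t = 0 when c ≤ m; the weight of
-- Q-vertices carries the bonus 2 exactly when the component is large (c > m).
component-arith : ∀ m s q t c → c ≡ s + q + t → q + 2 * s ≡ c ⊓ m → (c ≤ m → t ≡ 0) →
  s * (m + 2 * (s + q)) + q * (2 * m + 2 * 𝟙 (m <ᵇ c)) + t * (4 * s)
    ≤ s * (2 * m + 2) + q * (2 * m) + t * (2 * m)
component-arith m s q t c c≡ size noI with m <ᵇ c in large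
... | false rewrite noI (<ᵇ-false m c large)
                  | small-component-no-S s q c (trans c≡ (+-identityʳ (s + q)))
                                               (trans size (m≤n⇒m⊓n≡m (<ᵇ-false m c large)))
  = ≤-reflexive (cong (λ z → q * z + 0) (+-identityʳ (2 * m)))
... | true with m | trans size (m≥n⇒m⊓n≡n (<⇒≤ (<ᵇ-true m c large))) | <ᵇ-true m c large
...   | .(q + 2 * s) | refl | m<c = large-component s q t c c≡ m<c

module PerColour {N k : ℕ} (G : ColGraph N k) (n : ℕ) (part : Fin k → Fin N → Part)
                 (valid : ValidPartition G n part) (i : Fin k) where
  open Connectivity G i
  open Components G i

  m : ℕ
  m = n ∸ 1

  P : Fin N → Part
  P = part i

  inComp nbrs : Part → Fin N → ℕ
  inComp X v = count (λ x → reachable v x ∧ is X (P x))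
  nbrs X v = count (λ x → adj v x ∧ is X (P x))

  size : Fin N → ℕ
  size v = count (reachable v)

  large : Fin N → ℕ
  large v = 𝟙 (m <ᵇ size v)

  size-split : ∀ v → size v ≡ inComp S v + inComp Q v + inComp I v
  size-split v = count-by-part (reachable v) P

  degree-split : ∀ v → degᵢ G i v ≡ nbrs S v + nbrs Q v + nbrs I v
  degree-split v = trans (length-filter-allFin (edge? G i v)) (count-by-part (adj v) P)

  Invariant : (Fin N → ℕ) → Set
  Invariant A = ∀ {v w} → Reach G i v w → A v ≡ A w

  inComp-invariant : ∀ X → Invariant (inComp X)
  inComp-invariant X vw = sum-cong-≗ (λ x → cong (λ b → 𝟙 (b ∧ is X (P x))) (reachable-cong vw x))

  size-invariant : Invariant size
  size-invariant vw = sum-cong-≗ (λ x → cong 𝟙 (reachable-cong vw x))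

  large-invariant : Invariant large
  large-invariant vw = cong (λ c → 𝟙 (m <ᵇ c)) (size-invariant vw)

  component-represented : ∀ v → Vec.tabulate (reachable v) represents Reach G i v
  component-represented v = represents-tabulate (reachable v) reachable-sound reachable-complete

  part-represented : ∀ X v → Vec.tabulate (λ x → reachable v x ∧ is X (P x))
                               represents (λ x → Reach G i v x × P x ≡ X)
  part-represented X v = represents-tabulate _ sound complete
    where
    sound : ∀ {x} → reachable v x ∧ is X (P x) ≡ true → Reach G i v x × P x ≡ X
    sound {x} h with ∧-true (reachable v x) h
    ... | vx , Px = reachable-sound vx , is-sound X (P x) Px
    complete : ∀ {x} → Reach G i v x × P x ≡ X → reachable v x ∧ is X (P x) ≡ true
    complete (vx , refl) = ∧-intro (reachable-complete vx) (is-refl X)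

  condition-1 : ∀ v → inComp Q v + 2 * inComp S v ≡ size v ⊓ m
  condition-1 v = begin
    inComp Q v + 2 * inComp S v
      ≡⟨ sym (cong₂ (λ q s → q + 2 * s) (∣tabulate∣ (λ x → reachable v x ∧ is Q (P x)))
                                         (∣tabulate∣ (λ x → reachable v x ∧ is S (P x)))) ⟩
    ∣ Vec.tabulate (λ x → reachable v x ∧ is Q (P x)) ∣ + 2 * ∣ Vec.tabulate (λ x → reachable v x ∧ is S (P x)) ∣
      ≡⟨ proj₁ valid i v _ _ _ (part-represented S v) (part-represented Q v) (component-represented v) ⟩
    ∣ Vec.tabulate (reachable v) ∣ ⊓ m
      ≡⟨ cong (_⊓ m) (∣tabulate∣ (reachable v)) ⟩
    size v ⊓ m ∎
    where open ≡-Reasoning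

  I-independent : ∀ v → P v ≡ I → nbrs I v ≡ 0
  I-independent v Pv = trans (sum-cong-≗ no-I-nbr) (trans (∑-const N 0) (*-zeroʳ N))
    where
    no-I-nbr : ∀ x → 𝟙 (adj v x ∧ is I (P x)) ≡ 0
    no-I-nbr x with adj v x in vx | P x in Px
    ... | false | _ = refl
    ... | true | S = refl
    ... | true | Q = refl
    ... | true | I = ⊥-elim (proj₁ (proj₂ valid) i v x (adj-sound vx) Pv Px)

  small-no-I : ∀ v → size v ≤ m → inComp I v ≡ 0
  small-no-I v small = trans (sum-cong-≗ no-I) (trans (∑-const N 0) (*-zeroʳ N))
    where
    no-I : ∀ x → 𝟙 (reachable v x ∧ is I (P x)) ≡ 0
    no-I x with reachable v x in vx | P x in Px
    ... | false | _ = refl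
    ... | true | S = refl
    ... | true | Q = refl
    ... | true | I = ⊥-elim (proj₁ (proj₂ (proj₂ valid)) i x _ (component-represented x)
                         (subst (_≤ m) (sym (trans (∣tabulate∣ (reachable x)) (size-invariant (reach-sym (reachable-sound vx)))))
                                small) Px)

  Q-few-I : ∀ v → P v ≡ Q → nbrs I v ≤ 1
  Q-few-I v Pv = subst (_≤ 1) (trans (length-filterᵇ-allFin (λ u → if adj v u then isI (P u) else false)) (sum-cong-≗ (λ x → I-nbr (adj v x) (P x))))
                       (proj₁ (proj₂ (proj₂ (proj₂ valid))) i v Pv)
    where
    I-nbr : ∀ a p → 𝟙 (if a then isI p else false) ≡ 𝟙 (a ∧ is I p)
    I-nbr false p = refl
    I-nbr true S = refl
    I-nbr true Q = refl
    I-nbr true I = refl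

  nbrs≤inComp : ∀ X v → nbrs X v ≤ inComp X v
  nbrs≤inComp X v = ∑-mono-≤ nbr-in-comp
    where
    nbr-in-comp : ∀ x → 𝟙 (adj v x ∧ is X (P x)) ≤ 𝟙 (reachable v x ∧ is X (P x))
    nbr-in-comp x with adj v x in vx
    ... | false = z≤n
    ... | true rewrite reachable-complete (step (adj-sound vx) here) = ≤-refl

  closed-nbhd : ∀ v → P v ≢ I → nbrs S v + nbrs Q v + 1 ≤ inComp S v + inComp Q v
  closed-nbhd v Pv≢I = begin
    nbrs S v + nbrs Q v + 1
      ≡⟨ sym (cong₂ _+_ (∑-distrib-+ (λ x → 𝟙 (adj v x ∧ is S (P x))) (λ x → 𝟙 (adj v x ∧ is Q (P x)))) (∑-δ v)) ⟩
    ∑[ x < N ] (𝟙 (adj v x ∧ is S (P x)) + 𝟙 (adj v x ∧ is Q (P x))) + ∑[ x < N ] 𝟙 (does (v ≟ᶠ x))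
      ≡⟨ sym (∑-distrib-+ (λ x → 𝟙 (adj v x ∧ is S (P x)) + 𝟙 (adj v x ∧ is Q (P x))) (λ x → 𝟙 (does (v ≟ᶠ x)))) ⟩
    ∑[ x < N ] (𝟙 (adj v x ∧ is S (P x)) + 𝟙 (adj v x ∧ is Q (P x)) + 𝟙 (does (v ≟ᶠ x)))
      ≤⟨ ∑-mono-≤ member ⟩
    ∑[ x < N ] (𝟙 (reachable v x ∧ is S (P x)) + 𝟙 (reachable v x ∧ is Q (P x)))
      ≡⟨ ∑-distrib-+ (λ x → 𝟙 (reachable v x ∧ is S (P x))) (λ x → 𝟙 (reachable v x ∧ is Q (P x))) ⟩
    inComp S v + inComp Q v ∎
    where
    open ≤-Reasoning
    member : ∀ x → 𝟙 (adj v x ∧ is S (P x)) + 𝟙 (adj v x ∧ is Q (P x)) + 𝟙 (does (v ≟ᶠ x))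
                   ≤ 𝟙 (reachable v x ∧ is S (P x)) + 𝟙 (reachable v x ∧ is Q (P x))
    member x with v ≟ᶠ x
    member x | yes refl rewrite adj-irrefl x | reachable-self x with P x
    ... | S = ≤-refl
    ... | Q = ≤-refl
    ... | I = ⊥-elim (Pv≢I refl)
    member x | no _ with adj v x in vx
    ... | false = z≤n
    ... | true rewrite reachable-complete (step (adj-sound vx) here) = ≤-reflexive (+-identityʳ _)

  -- Condition (3) bounds the degree of a Q-vertex by m.
  Q-degree : ∀ v → P v ≡ Q → degᵢ G i v ≤ m
  Q-degree v Pv = begin
    degᵢ G i v                   ≡⟨ degree-split v ⟩
    nbrs S v + nbrs Q v + nbrs I v ≤⟨ +-monoʳ-≤ (nbrs S v + nbrs Q v) (Q-few-I v Pv) ⟩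
    nbrs S v + nbrs Q v + 1       ≤⟨ closed-nbhd v (λ Pv≡I → Q≢I (trans (sym Pv) Pv≡I)) ⟩
    inComp S v + inComp Q v       ≤⟨ ≤-reflexive (+-comm (inComp S v) (inComp Q v)) ⟩
    inComp Q v + inComp S v       ≤⟨ +-monoʳ-≤ (inComp Q v) (m≤m+n (inComp S v) (inComp S v + 0)) ⟩
    inComp Q v + 2 * inComp S v   ≡⟨ condition-1 v ⟩
    size v ⊓ m                    ≤⟨ m⊓n≤n (size v) m ⟩
    m                             ∎
    where
    open ≤-Reasoning
    Q≢I : Q ≢ I
    Q≢I ()

  Q-I-nbrs≤large : ∀ v → P v ≡ Q → nbrs I v ≤ large v
  Q-I-nbrs≤large v Pv with m <ᵇ size v in lg
  ... | true = Q-few-I v Pv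
  ... | false = ≤-trans (nbrs≤inComp I v) (≤-reflexive (small-no-I v (<ᵇ-false m (size v) lg)))

  weight : Fin N → ℕ
  weight v = byPart (P v) m (2 * m ∸ 2 * degᵢ G i v) 0

  𝟙[_] : Part → Fin N → ℕ
  𝟙[ X ] v = 𝟙 (is X (P v))

  -- Edges from S to I and from I to Q are charged to their I-end and Q-end
  -- respectively; base is what remains.
  base : Fin N → ℕ
  base v = byPart (P v) (m + 2 * (nbrs S v + nbrs Q v)) (2 * m) (2 * nbrs S v)

  weight-bound-at : ∀ p d a b c → d ≡ a + b + c → (p ≡ Q → d ≤ m) → (p ≡ I → c ≡ 0) →
    byPart p m (2 * m ∸ 2 * d) 0 + 2 * d
      ≤ byPart p (m + 2 * (a + b)) (2 * m) (2 * a) + 2 * (𝟙 (is S p) * c) + 2 * (𝟙 (is I p) * b)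
  weight-bound-at S d a b c refl _ _ = ≤-reflexive
    (solve 4 (λ m a b c → m :+ con 2 :* (a :+ b :+ c) := m :+ con 2 :* (a :+ b) :+ con 2 :* (con 1 :* c) :+ con 0)
             refl m a b c)
  weight-bound-at Q d a b c _ d≤m _ = ≤-reflexive
    (trans (m∸n+n≡m (*-monoʳ-≤ 2 (d≤m refl))) (sym (trans (+-identityʳ (2 * m + 0)) (+-identityʳ (2 * m)))))
  weight-bound-at I d a b c refl _ c≡0 rewrite c≡0 refl = ≤-reflexive
    (solve 2 (λ a b → con 2 :* (a :+ b :+ con 0) := con 2 :* a :+ con 0 :+ con 2 :* (con 1 :* b)) refl a b)

  weight-bound : ∀ v → weight v + 2 * degᵢ G i v ≤ base v + 2 * (𝟙[ S ] v * nbrs I v) + 2 * (𝟙[ I ] v * nbrs Q v)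
  weight-bound v = weight-bound-at (P v) _ _ _ _ (degree-split v) (Q-degree v) (I-independent v)

  -- Step 2: by double counting, the S–I edges may be charged to the I-end
  -- instead of the S-end, and the I–Q edges to the Q-end instead of the I-end.
  rebalance : ∑[ v < N ] (base v + 2 * (𝟙[ S ] v * nbrs I v) + 2 * (𝟙[ I ] v * nbrs Q v))
            ≡ ∑[ v < N ] (base v + 2 * (𝟙[ I ] v * nbrs S v) + 2 * (𝟙[ Q ] v * nbrs I v))
  rebalance = begin
    ∑[ v < N ] (base v + 2 * (𝟙[ S ] v * nbrs I v) + 2 * (𝟙[ I ] v * nbrs Q v))
      ≡⟨ expand (λ v → 𝟙[ S ] v * nbrs I v) (λ v → 𝟙[ I ] v * nbrs Q v) ⟩
    sum base + 2 * ∑[ v < N ] (𝟙[ S ] v * nbrs I v) + 2 * ∑[ v < N ] (𝟙[ I ] v * nbrs Q v)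
      ≡⟨ cong₂ (λ x y → sum base + 2 * x + 2 * y) (crossing S I) (crossing I Q) ⟩
    sum base + 2 * ∑[ v < N ] (𝟙[ I ] v * nbrs S v) + 2 * ∑[ v < N ] (𝟙[ Q ] v * nbrs I v)
      ≡⟨ sym (expand (λ v → 𝟙[ I ] v * nbrs S v) (λ v → 𝟙[ Q ] v * nbrs I v)) ⟩
    ∑[ v < N ] (base v + 2 * (𝟙[ I ] v * nbrs S v) + 2 * (𝟙[ Q ] v * nbrs I v)) ∎
    where
    open ≡-Reasoning
    crossing : ∀ X Y → ∑[ v < N ] (𝟙[ X ] v * nbrs Y v) ≡ ∑[ v < N ] (𝟙[ Y ] v * nbrs X v)
    crossing X Y = double-count adj adj-sym (is X ∘ P) (is Y ∘ P)
    expand : ∀ f g → ∑[ v < N ] (base v + 2 * f v + 2 * g v) ≡ sum base + 2 * sum f + 2 * sum g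
    expand f g = trans (∑-+2* (λ v → base v + 2 * f v) g) (cong (_+ 2 * sum g) (∑-+2* base f))

  local : Fin N → ℕ
  local v = byPart (P v) (m + 2 * (inComp S v + inComp Q v)) (2 * m + 2 * large v) (4 * inComp S v)

  local-bound-at : ∀ p a b c s q L → (p ≢ I → a + b + 1 ≤ s + q) → (p ≡ I → a ≤ s) → (p ≡ Q → c ≤ L) →
    byPart p (m + 2 * (a + b)) (2 * m) (2 * a) + 2 * (𝟙 (is I p) * a) + 2 * (𝟙 (is Q p) * c) + 2 * 𝟙 (is S p)
      ≤ byPart p (m + 2 * (s + q)) (2 * m + 2 * L) (4 * s)
  local-bound-at S a b c s q L closed _ _ = begin
    m + 2 * (a + b) + 0 + 0 + 2 * 1
      ≡⟨ solve 3 (λ m a b → m :+ con 2 :* (a :+ b) :+ con 0 :+ con 0 :+ con 2 :* con 1 := m :+ con 2 :* (a :+ b :+ con 1))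
               refl m a b ⟩
    m + 2 * (a + b + 1) ≤⟨ +-monoʳ-≤ m (*-monoʳ-≤ 2 (closed (λ ()))) ⟩
    m + 2 * (s + q)     ∎
    where open ≤-Reasoning
  local-bound-at Q a b c s q L _ _ c≤L = begin
    2 * m + 0 + 2 * (1 * c) + 2 * 0
      ≡⟨ solve 2 (λ m c → con 2 :* m :+ con 0 :+ con 2 :* (con 1 :* c) :+ con 2 :* con 0 := con 2 :* m :+ con 2 :* c)
               refl m c ⟩
    2 * m + 2 * c ≤⟨ +-monoʳ-≤ (2 * m) (*-monoʳ-≤ 2 (c≤L refl)) ⟩
    2 * m + 2 * L ∎
    where open ≤-Reasoning
  local-bound-at I a b c s q L _ a≤s _ = begin
    2 * a + 2 * (1 * a) + 0 + 2 * 0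
      ≡⟨ solve 1 (λ a → con 2 :* a :+ con 2 :* (con 1 :* a) :+ con 0 :+ con 2 :* con 0 := con 4 :* a) refl a ⟩
    4 * a ≤⟨ *-monoʳ-≤ 4 (a≤s refl) ⟩
    4 * s ∎
    where open ≤-Reasoning

  local-bound : ∀ v → base v + 2 * (𝟙[ I ] v * nbrs S v) + 2 * (𝟙[ Q ] v * nbrs I v) + 2 * 𝟙[ S ] v ≤ local v
  local-bound v = local-bound-at (P v) _ _ _ _ _ _ (closed-nbhd v) (λ _ → nbrs≤inComp S v) (Q-I-nbrs≤large v)

  ∑-on-component : ∀ (A B C : Fin N → ℕ) → Invariant A → Invariant B → Invariant C → ∀ r →
    ∑[ v < N ] (𝟙 (reachable r v) * byPart (P v) (A v) (B v) (C v))
      ≡ inComp S r * A r + inComp Q r * B r + inComp I r * C r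
  ∑-on-component A B C inv-A inv-B inv-C r = begin
    ∑[ v < N ] (𝟙 (reachable r v) * byPart (P v) (A v) (B v) (C v))
      ≡⟨ sum-cong-≗ by-parts ⟩
    ∑[ v < N ] (𝟙 (in-part S v) * A r + 𝟙 (in-part Q v) * B r + 𝟙 (in-part I v) * C r)
      ≡⟨ ∑-distrib-+ (λ v → 𝟙 (in-part S v) * A r + 𝟙 (in-part Q v) * B r) (λ v → 𝟙 (in-part I v) * C r) ⟩
    ∑[ v < N ] (𝟙 (in-part S v) * A r + 𝟙 (in-part Q v) * B r) + ∑[ v < N ] (𝟙 (in-part I v) * C r)
      ≡⟨ cong (_+ ∑[ v < N ] (𝟙 (in-part I v) * C r)) (∑-distrib-+ (λ v → 𝟙 (in-part S v) * A r) (λ v → 𝟙 (in-part Q v) * B r)) ⟩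
    ∑[ v < N ] (𝟙 (in-part S v) * A r) + ∑[ v < N ] (𝟙 (in-part Q v) * B r) + ∑[ v < N ] (𝟙 (in-part I v) * C r)
      ≡⟨ sym (cong₂ _+_ (cong₂ _+_ (*-distribʳ-sum (A r) (𝟙 ∘ in-part S)) (*-distribʳ-sum (B r) (𝟙 ∘ in-part Q)))
                        (*-distribʳ-sum (C r) (𝟙 ∘ in-part I))) ⟩
    inComp S r * A r + inComp Q r * B r + inComp I r * C r ∎
    where
    open ≡-Reasoning
    in-part : Part → Fin N → Bool
    in-part X v = reachable r v ∧ is X (P v)
    by-parts : ∀ v → 𝟙 (reachable r v) * byPart (P v) (A v) (B v) (C v)
                     ≡ 𝟙 (in-part S v) * A r + 𝟙 (in-part Q v) * B r + 𝟙 (in-part I v) * C r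
    by-parts v with reachable r v in rv | P v
    ... | false | _ = refl
    ... | true | S = trans (cong (1 *_) (sym (inv-A (reachable-sound rv))))
                           (sym (trans (+-identityʳ (1 * A r + 0)) (+-identityʳ (1 * A r))))
    ... | true | Q = trans (cong (1 *_) (sym (inv-B (reachable-sound rv)))) (sym (+-identityʳ (1 * B r)))
    ... | true | I = cong (1 *_) (sym (inv-C (reachable-sound rv)))

  component-bound : sum local ≤ ∑[ v < N ] byPart (P v) (2 * m + 2) (2 * m) (2 * m)
  component-bound = ∑-mono-by-components local _ λ r → begin
    ∑[ v < N ] (𝟙 (reachable r v) * local v)
      ≡⟨ ∑-on-component (λ v → m + 2 * (inComp S v + inComp Q v)) (λ v → 2 * m + 2 * large v) (λ v → 4 * inComp S v)
                         (λ vw → cong₂ (λ s q → m + 2 * (s + q)) (inComp-invariant S vw) (inComp-invariant Q vw))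
                         (λ vw → cong (λ L → 2 * m + 2 * L) (large-invariant vw))
                         (λ vw → cong (4 *_) (inComp-invariant S vw)) r ⟩
    inComp S r * (m + 2 * (inComp S r + inComp Q r)) + inComp Q r * (2 * m + 2 * large r) + inComp I r * (4 * inComp S r)
      ≤⟨ component-arith m (inComp S r) (inComp Q r) (inComp I r) (size r) (size-split r) (condition-1 r) (small-no-I r) ⟩
    inComp S r * (2 * m + 2) + inComp Q r * (2 * m) + inComp I r * (2 * m)
      ≡⟨ sym (∑-on-component (λ _ → 2 * m + 2) (λ _ → 2 * m) (λ _ → 2 * m) (λ _ → refl) (λ _ → refl) (λ _ → refl) r) ⟩
    ∑[ v < N ] (𝟙 (reachable r v) * byPart (P v) (2 * m + 2) (2 * m) (2 * m)) ∎
    where open ≤-Reasoning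

  colour-bound : ∑[ v < N ] (weight v + 2 * degᵢ G i v) ≤ N * (2 * m)
  colour-bound = +-cancelʳ-≤ (2 * strong) _ _ (begin
    ∑[ v < N ] (weight v + 2 * degᵢ G i v) + 2 * strong
      ≤⟨ +-monoˡ-≤ (2 * strong) (∑-mono-≤ weight-bound) ⟩
    ∑[ v < N ] (base v + 2 * (𝟙[ S ] v * nbrs I v) + 2 * (𝟙[ I ] v * nbrs Q v)) + 2 * strong
      ≡⟨ cong (_+ 2 * strong) rebalance ⟩
    ∑[ v < N ] (base v + 2 * (𝟙[ I ] v * nbrs S v) + 2 * (𝟙[ Q ] v * nbrs I v)) + 2 * strong
      ≡⟨ sym (∑-+2* (λ v → base v + 2 * (𝟙[ I ] v * nbrs S v) + 2 * (𝟙[ Q ] v * nbrs I v)) 𝟙[ S ]) ⟩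
    ∑[ v < N ] (base v + 2 * (𝟙[ I ] v * nbrs S v) + 2 * (𝟙[ Q ] v * nbrs I v) + 2 * 𝟙[ S ] v)
      ≤⟨ ∑-mono-≤ local-bound ⟩
    sum local
      ≤⟨ component-bound ⟩
    ∑[ v < N ] byPart (P v) (2 * m + 2) (2 * m) (2 * m)
      ≡⟨ sum-cong-≗ (λ v → per-vertex (P v)) ⟩
    ∑[ v < N ] (2 * m + 2 * 𝟙[ S ] v)
      ≡⟨ ∑-+2* (λ _ → 2 * m) 𝟙[ S ] ⟩
    ∑[ _ < N ] (2 * m) + 2 * strong
      ≡⟨ cong (_+ 2 * strong) (∑-const N (2 * m)) ⟩
    N * (2 * m) + 2 * strong ∎)
    where
    open ≤-Reasoning
    strong : ℕ
    strong = sum 𝟙[ S ]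
    per-vertex : ∀ p → byPart p (2 * m + 2) (2 * m) (2 * m) ≡ 2 * m + 2 * 𝟙 (is S p)
    per-vertex S = refl
    per-vertex Q = sym (+-identityʳ (2 * m))
    per-vertex I = sym (+-identityʳ (2 * m))

module Degrees {N k : ℕ} (G : ColGraph N k) where

  degree-by-colour : ∀ v → deg G v ≡ ∑[ i < k ] degᵢ G i v
  degree-by-colour v = begin
    deg G v
      ≡⟨ length-filterᵇ-allFin (λ u → is-just (col G v u)) ⟩
    ∑[ u < N ] 𝟙 (is-just (col G v u))
      ≡⟨ sum-cong-≗ (λ u → one-colour (col G v u)) ⟩
    ∑[ u < N ] ∑[ i < k ] 𝟙 (does (edge? G i v u))
      ≡⟨ ∑-comm (λ u i → 𝟙 (does (edge? G i v u))) ⟩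
    ∑[ i < k ] ∑[ u < N ] 𝟙 (does (edge? G i v u))
      ≡⟨ sum-cong-≗ (λ i → sym (length-filter-allFin (edge? G i v))) ⟩
    ∑[ i < k ] degᵢ G i v ∎
    where
    open ≡-Reasoning
    one-colour : (c : Maybe (Fin k)) → 𝟙 (is-just c) ≡ ∑[ i < k ] 𝟙 (does (≡-dec _≟ᶠ_ c (just i)))
    one-colour nothing = sym (trans (∑-const k 0) (*-zeroʳ k))
    one-colour (just j) = sym (trans (sum-cong-≗ same) (∑-δ j))
      where
      same : ∀ i → 𝟙 (does (≡-dec _≟ᶠ_ (just j) (just i))) ≡ 𝟙 (does (j ≟ᶠ i))
      same i with j ≟ᶠ i
      ... | yes _ = refl
      ... | no _ = refl

  -- whether uv is an edge with u < v, so that numEdges counts each edge once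
  ordered : Fin N → Fin N → Bool
  ordered u v = if does (toℕ u <? toℕ v) then is-just (col G u v) else false

  edge-once : ∀ u v → 𝟙 (is-just (col G u v)) ≡ 𝟙 (ordered u v) + 𝟙 (ordered v u)
  edge-once u v rewrite ColGraph.sym G v u with <-cmp (toℕ u) (toℕ v)
  ... | tri< u<v _ v≮u rewrite dec-true (toℕ u <? toℕ v) u<v | dec-false (toℕ v <? toℕ u) v≮u = sym (+-identityʳ _)
  ... | tri> u≮v _ v<u rewrite dec-false (toℕ u <? toℕ v) u≮v | dec-true (toℕ v <? toℕ u) v<u = refl
  ... | tri≈ u≮v u≡v _ with toℕ-injective u≡v
  ...   | refl rewrite ColGraph.irrefl G u | dec-false (toℕ u <? toℕ u) u≮v = refl

  handshake : 2 * numEdges G ≡ ∑[ v < N ] deg G v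
  handshake = begin
    2 * numEdges G
      ≡⟨ cong (2 *_) (trans (sum-map-allFin (λ u → length (filterᵇ (ordered u) (allFin N))))
                             (sum-cong-≗ (λ u → length-filterᵇ-allFin (ordered u)))) ⟩
    2 * E
      ≡⟨ cong (E +_) (trans (+-identityʳ E) (∑-comm (λ u v → 𝟙 (ordered u v)))) ⟩
    E + ∑[ u < N ] ∑[ v < N ] 𝟙 (ordered v u)
      ≡⟨ sym (∑-distrib-+ (λ u → count (ordered u)) (λ u → ∑[ v < N ] 𝟙 (ordered v u))) ⟩
    ∑[ u < N ] (count (ordered u) + ∑[ v < N ] 𝟙 (ordered v u))
      ≡⟨ sum-cong-≗ (λ u → sym (∑-distrib-+ (λ v → 𝟙 (ordered u v)) (λ v → 𝟙 (ordered v u)))) ⟩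
    ∑[ u < N ] ∑[ v < N ] (𝟙 (ordered u v) + 𝟙 (ordered v u))
      ≡⟨ sum-cong-≗ (λ u → trans (sum-cong-≗ (λ v → sym (edge-once u v)))
                                 (sym (length-filterᵇ-allFin (λ v → is-just (col G u v))))) ⟩
    ∑[ u < N ] deg G u ∎
    where
    open ≡-Reasoning
    E : ℕ
    E = ∑[ u < N ] count (ordered u)

minus-≤ : ∀ {a b c} → a ≤ c + b → ℤ.+ a ℤ.- ℤ.+ b ℤ.≤ ℤ.+ c
minus-≤ {a} {b} {c} a≤c+b rewrite ℤP.[+m]-[+n]≡m⊖n a b with b ≤? a
... | yes b≤a rewrite ℤP.⊖-≥ b≤a = ℤ.+≤+ (m≤n+o⇒m∸n≤o a b (≤-trans a≤c+b (≤-reflexive (+-comm c b))))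
... | no b≰a rewrite ℤP.⊖-< (≰⇒> b≰a) = ℤP.neg-≤-pos

≤-minus : ∀ {a b c} → a + b ≤ c → ℤ.+ a ℤ.≤ ℤ.+ c ℤ.- ℤ.+ b
≤-minus {a} {b} {c} a+b≤c rewrite ℤP.[+m]-[+n]≡m⊖n c b | ℤP.⊖-≥ (≤-trans (m≤n+m b a) a+b≤c) =
  ℤ.+≤+ (m+n≤o⇒m≤o∸n a a+b≤c)

∑ℤ-bound : ∀ {n} (F : Fin n → ℤ) (g : Fin n → ℕ) → (∀ x → F x ℤ.≤ ℤ.+ g x) →
  foldr ℤ._+_ (ℤ.+ 0) (map F (allFin n)) ℤ.≤ ℤ.+ sum g
∑ℤ-bound F g F≤g = go F g id F≤g
  where
  go : ∀ {n} {A : Set} (F : A → ℤ) (g : Fin n → ℕ) (h : Fin n → A) → (∀ x → F (h x) ℤ.≤ ℤ.+ g x) →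
       foldr ℤ._+_ (ℤ.+ 0) (map F (Data.List.tabulate h)) ℤ.≤ ℤ.+ sum g
  go {zero} F g h F≤g = ℤ.+≤+ z≤n
  go {suc n} F g h F≤g = ℤP.+-mono-≤ (F≤g zero) (go F (g ∘ suc) (h ∘ suc) (F≤g ∘ suc))

module Total {N k : ℕ} (G : ColGraph N k) (n : ℕ) (part : Fin k → Fin N → Part)
             (valid : ValidPartition G n part) where
  open Degrees G

  m : ℕ
  m = n ∸ 1

  weight : Fin k → Fin N → ℕ
  weight = PerColour.weight G n part valid

  total-weight : Fin N → ℕ
  total-weight v = ∑[ i < k ] weight i v

  weight-strong : ∀ j v → isS (part j v) ≡ true → weight j v ≡ m
  weight-strong j v Sj with part j v
  ... | S = refl

  Q-saturated-bound : ∀ v → (∀ i → part i v ≡ Q) → 2 * k * m ≤ total-weight v + 2 * deg G v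
  Q-saturated-bound v saturated = begin
    2 * k * m
      ≡⟨ solve 2 (λ k m → con 2 :* k :* m := k :* (con 2 :* m)) refl k m ⟩
    k * (2 * m)
      ≡⟨ sym (∑-const k (2 * m)) ⟩
    ∑[ _ < k ] (2 * m)
      ≤⟨ ∑-mono-≤ in-colour ⟩
    ∑[ i < k ] (weight i v + 2 * degᵢ G i v)
      ≡⟨ ∑-+2* (λ i → weight i v) (λ i → degᵢ G i v) ⟩
    total-weight v + 2 * ∑[ i < k ] degᵢ G i v
      ≡⟨ cong (λ d → total-weight v + 2 * d) (sym (degree-by-colour v)) ⟩
    total-weight v + 2 * deg G v ∎
    where
    open ≤-Reasoning
    in-colour : ∀ i → 2 * m ≤ weight i v + 2 * degᵢ G i v
    in-colour i rewrite saturated i =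
      ≤-trans (m≤n+m∸n (2 * m) (2 * degᵢ G i v)) (≤-reflexive (+-comm (2 * degᵢ G i v) _))

  F4-bound : ∀ v → F4 G n part v ℤ.≤ ℤ.+ total-weight v
  F4-bound v with any (λ i → isS (part i v)) (allFin k) in strong
  ... | true with any-elim _ strong
  ...   | j , Sj = ℤ.+≤+ (≤-trans (≤-reflexive (sym (weight-strong j v Sj))) (∑-term (λ i → weight i v) j))
  F4-bound v | false with any (λ i → isI (part i v)) (allFin k) in small
  ... | true = ℤ.+≤+ z≤n
  ... | false = minus-≤ (Q-saturated-bound v (λ i → only-Q (any-false _ strong i) (any-false _ small i)))
    where
    only-Q : ∀ {p} → isS p ≡ false → isI p ≡ false → p ≡ Q
    only-Q {Q} _ _ = refl

  weights-and-edges : sum total-weight + 4 * numEdges G ≤ 2 * k * m * N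
  weights-and-edges = begin
    sum total-weight + 4 * numEdges G
      ≡⟨ cong (sum total-weight +_) (trans (*-assoc 2 2 (numEdges G)) (cong (2 *_) handshake)) ⟩
    sum total-weight + 2 * ∑[ v < N ] deg G v
      ≡⟨ sym (∑-+2* total-weight (deg G)) ⟩
    ∑[ v < N ] (total-weight v + 2 * deg G v)
      ≡⟨ sum-cong-≗ (λ v → cong (λ d → total-weight v + 2 * d) (degree-by-colour v)) ⟩
    ∑[ v < N ] (total-weight v + 2 * ∑[ i < k ] degᵢ G i v)
      ≡⟨ sum-cong-≗ (λ v → sym (∑-+2* (λ i → weight i v) (λ i → degᵢ G i v))) ⟩
    ∑[ v < N ] ∑[ i < k ] (weight i v + 2 * degᵢ G i v)
      ≡⟨ ∑-comm (λ v i → weight i v + 2 * degᵢ G i v) ⟩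
    ∑[ i < k ] ∑[ v < N ] (weight i v + 2 * degᵢ G i v)
      ≤⟨ ∑-mono-≤ (PerColour.colour-bound G n part valid) ⟩
    ∑[ _ < k ] (N * (2 * m))
      ≡⟨ ∑-const k (N * (2 * m)) ⟩
    k * (N * (2 * m))
      ≡⟨ solve 3 (λ k N m → k :* (N :* (con 2 :* m)) := con 2 :* k :* m :* N) refl k N m ⟩
    2 * k * m * N ∎
    where open ≤-Reasoning

  F-bound : sumF4 G n part ℤ.≤ FG4 G n
  F-bound = ℤP.≤-trans (∑ℤ-bound (F4 G n part) total-weight F4-bound) (≤-minus weights-and-edges)

-- The inequality only uses conditions (1)–(3) of the
-- partitions.
corollary14 : (n k N : ℕ) → 1 Data.Nat.≤ n → 2 ∣ n → 1 Data.Nat.≤ k →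
    (G : ColGraph N k) →
    ¬ MonoConnMatching G (n / 2) →
    (part : Fin k → Fin N → Part) →
    ValidPartition G n part →
    sumF4 G n part Data.Integer.≤ FG4 G n
corollary14 n k N _ _ _ G _ part valid = Total.F-bound G n part valid
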